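{- Let $p\ge1$, let $0\le r_1\leq r_2\leq\cdots\leq r_p$ be integers and $n\ge 0$ an integer. Write $\mathbf r_p=(r_1,\dots,r_p)$, $|\mathbf r_p|=r_1+\cdots+r_p$ and $|\mathbf r_{p-1}|=r_1+\cdots+r_{p-1}$. Then, as polynomials in $z$, \[ (z+r_p)_{r_1}\cdots(z+r_p)_{r_{p-1}}(z+r_p)^n=\sum_{k=0}^{n+|\mathbf r_{p-1}|}{n+|\mathbf r_p| \brace k+r_p}_{\!\mathbf r_p}(z)_k . \] In particular, for every integer $r\ge0$, \[ (z+r)^n=\sum_{k=0}^{n}{n+r \brace k+r}_{\!r}(z)_k . \]
   Context: $(x)_m=x(x-1)\cdots(x-m+1)$ for $m\ge1$, $(x)_0=1$. For nonnegative integers $r_1,\dots,r_p$ and $N$, let $R_1,\dots,R_p$ be pairwise disjoint subsets of $\{1,\dots,N\}$ with $|R_i|=r_i$; the $(r_1,\dots,r_p)$-Stirling number of the second kind ${N \brace k}_{r_1,\dots,r_p}$ is the number of partitions of $\{1,\dots,N\}$ into $k$ nonempty blocks such that, for each $i$, the elements of $R_i$ lie in distinct blocks (this number does not depend on the choice of the $R_i$, and is $0$ if $N<r_1+\cdots+r_p$). For $p=1$ this is the $r$-Stirling number ${N\brace k}_r$. -}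

module Defs where

open import Data.Nat as ℕ using (ℕ; zero; suc; _≤?_)
open import Data.Fin as Fin using (Fin; toℕ)
open import Data.Fin.Properties using (_≟_; all?; any?) renaming (_<?_ to _<ᶠ?_)
open import Data.List using (List; []; _∷_; length; filter; map; concatMap; allFin)
open import Data.Nat.ListAction using (sum)
open import Data.Product using (∃; _×_; _,_)
open import Data.Sum using (_⊎_)
open import Data.Integer as ℤ using (ℤ; +_)
open import Relation.Nullary using (Dec; yes; no; ¬_; ¬?)
open import Relation.Nullary.Decidable using (_×-dec_; _⊎-dec_; _→-dec_)
open import Relation.Unary using (Decidable)
open import Relation.Binary.PropositionalEquality using (_≡_; _≢_)

fall : ℤ → ℕ → ℤ
fall x zero    = + 1
fall x (suc m) = fall x m ℤ.* (x ℤ.- + m)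

sumTo : ℕ → (ℕ → ℤ) → ℤ
sumTo zero    f = f 0
sumTo (suc M) f = sumTo M f ℤ.+ f (suc M)

prodL : List ℕ → (ℕ → ℤ) → ℤ
prodL []       f = + 1
prodL (r ∷ rs) f = f r ℤ.* prodL rs f

-- Set partitions of {0,…,N-1} into k nonempty blocks, encoded (bijectively)
-- as maps f : Fin N → Fin k (f i = label of the block containing i) that are
--  * surjective (every block is nonempty), and
--  * labelled canonically: blocks are numbered in order of their least
--    elements, i.e. every label j < f i already occurs at some position < i.

Surj : ∀ {N k} → (Fin N → Fin k) → Set
Surj {N} {k} f = ∀ (j : Fin k) → ∃ λ (i : Fin N) → f i ≡ j

Canonical : ∀ {N k} → (Fin N → Fin k) → Set
Canonical {N} {k} f =
  ∀ (i : Fin N) (j : Fin k) → j Fin.< f i → ∃ λ (i' : Fin N) → i' Fin.< i × f i' ≡ j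

-- The distinguished sets: for r = (r₁,…,r_p), R₁ = {0,…,r₁-1},
-- R₂ = {r₁,…,r₁+r₂-1}, …  (consecutive, pairwise disjoint).
-- SameR r a b  ⇔  a and b lie in a common R_i.
SameR : List ℕ → ℕ → ℕ → Set
SameR []       a b = ⊥'
  where open import Data.Empty renaming (⊥ to ⊥')
SameR (r ∷ rs) a b = (a ℕ.< r × b ℕ.< r) ⊎ (r ℕ.≤ a × r ℕ.≤ b × SameR rs (a ℕ.∸ r) (b ℕ.∸ r))

SameR? : ∀ rs a b → Dec (SameR rs a b)
SameR? []       a b = no (λ ())
SameR? (r ∷ rs) a b =
  ((suc a ≤? r) ×-dec (suc b ≤? r)) ⊎-dec ((r ≤? a) ×-dec ((r ≤? b) ×-dec SameR? rs (a ℕ.∸ r) (b ℕ.∸ r)))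

Separates : ∀ {N k} → List ℕ → (Fin N → Fin k) → Set
Separates {N} rs f = ∀ (i i' : Fin N) → i ≢ i' → SameR rs (toℕ i) (toℕ i') → f i ≢ f i'

Admissible : ∀ {N k} → List ℕ → (Fin N → Fin k) → Set
Admissible rs f = Surj f × Canonical f × Separates rs f

Admissible? : ∀ {N k} (rs : List ℕ) → Decidable (Admissible {N} {k} rs)
Admissible? rs f =
  all? (λ j → any? (λ i → f i ≟ j))
  ×-dec (all? (λ i → all? (λ j → (j <ᶠ? f i) →-dec any? (λ i' → (i' <ᶠ? i) ×-dec (f i' ≟ j))))
  ×-dec all? (λ i → all? (λ i' → ¬? (i ≟ i') →-dec (SameR? rs (toℕ i) (toℕ i') →-dec ¬? (f i ≟ f i')))))

allFuns : (N k : ℕ) → List (Fin N → Fin k)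
allFuns zero    k = (λ ()) ∷ []
allFuns (suc N) k =
  concatMap (λ g → map (λ j → λ { Fin.zero → j ; (Fin.suc i) → g i }) (allFin k)) (allFuns N k)

stirlingR : ℕ → ℕ → List ℕ → ℕ
stirlingR N k rs with sum rs ≤? N
... | yes _ = length (filter (Admissible? rs) (allFuns N k))
... | no  _ = 0

module Submission where

-- Idea: build a partition of {0,…,N-1} by inserting 0, 1, … in turn.  When
-- position i arrives, the m = rank i earlier members of its distinguished
-- set lie in m distinct blocks, so with u blocks present, i either joins one
-- of the u - m others or opens a new block.  Hence the Stirling number equals
-- an "insertion number" W (ranks) 0 k defined by this recursion alone.

open import Defs
open import Data.Nat using (ℕ; _+_; _≤_)
open import Data.Integer using (ℤ; +_) renaming (_+_ to _+ℤ_; _*_ to _*ℤ_; _^_ to _^ℤ_)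
open import Data.List using (List; _∷_; []; _∷ʳ_)
open import Data.Nat.ListAction using (sum)
open import Data.List.Relation.Unary.Sorted.TotalOrder using (Sorted)
open import Data.Nat.Properties using (≤-totalOrder)
open import Data.Product using (_×_)
open import Relation.Binary.PropositionalEquality using (_≡_)

open import Data.Nat using (zero; suc; _<_; _∸_; _<?_; _≤?_; _≟_; z≤n; s≤s)
import Data.Nat.Properties as ℕₚ
import Data.Nat.ListAction.Properties as ListActionₚ
open import Data.Integer using () renaming (_-_ to _-ℤ_)
import Data.Integer.Properties as ℤₚ
open import Data.Integer.Tactic.RingSolver using (solve-∀)
open import Data.Fin as Fin using (Fin; toℕ; fromℕ<)
import Data.Fin.Properties as Finₚ
open import Data.List using (_++_; length; map; filter; concatMap; allFin; tabulate; replicate)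
import Data.List.Properties as Listₚ
open import Data.List.Relation.Binary.Permutation.Propositional using (_↭_; refl; prep; swap; trans)
import Data.List.Relation.Binary.Permutation.Propositional.Properties as ↭ₚ
open import Data.Product using (∃; _,_; proj₁; proj₂)
open import Data.Sum using (inj₁; inj₂)
open import Data.Empty using (⊥-elim)
open import Relation.Nullary using (¬_; Dec; yes; no; ¬?)
open import Relation.Nullary.Decidable using (_×-dec_; _→-dec_; map′)
open import Relation.Unary using (Decidable)
open import Relation.Binary using (tri<; tri≈; tri>)
open import Relation.Binary.PropositionalEquality
  using (_≢_; refl; sym; subst; subst₂; cong; cong₂; module ≡-Reasoning) renaming (trans to ≡-trans)
open import Algebra.Properties.CommutativeSemigroup ℕₚ.+-commutativeSemigroup
  using () renaming (interchange to +-interchange)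
open import Algebra.Properties.CommutativeSemigroup ℤₚ.+-commutativeSemigroup
  using () renaming (interchange to +ℤ-interchange)

sumTo-cong : ∀ M {f g : ℕ → ℤ} → (∀ d → f d ≡ g d) → sumTo M f ≡ sumTo M g
sumTo-cong zero    f≗g = f≗g 0
sumTo-cong (suc M) f≗g = cong₂ _+ℤ_ (sumTo-cong M f≗g) (f≗g (suc M))

sumTo-+ : ∀ M (f g : ℕ → ℤ) → sumTo M (λ d → f d +ℤ g d) ≡ sumTo M f +ℤ sumTo M g
sumTo-+ zero    f g = refl
sumTo-+ (suc M) f g rewrite sumTo-+ M f g = +ℤ-interchange (sumTo M f) (sumTo M g) (f (suc M)) (g (suc M))

sumTo-*ˡ : ∀ M c (f : ℕ → ℤ) → sumTo M (λ d → c *ℤ f d) ≡ c *ℤ sumTo M f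
sumTo-*ˡ zero    c f = refl
sumTo-*ˡ (suc M) c f rewrite sumTo-*ˡ M c f = sym (ℤₚ.*-distribˡ-+ c (sumTo M f) (f (suc M)))

sumTo-shift : ∀ M (f : ℕ → ℤ) → sumTo (suc M) f ≡ f 0 +ℤ sumTo M (λ d → f (suc d))
sumTo-shift zero    f = refl
sumTo-shift (suc M) f rewrite sumTo-shift M f = ℤₚ.+-assoc (f 0) _ _

prodL-++ : ∀ xs ys (f : ℕ → ℤ) → prodL (xs ++ ys) f ≡ prodL xs f *ℤ prodL ys f
prodL-++ []       ys f = sym (ℤₚ.*-identityˡ _)
prodL-++ (x ∷ xs) ys f rewrite prodL-++ xs ys f = sym (ℤₚ.*-assoc (f x) _ _)

+-suc-ℤ : ∀ u → + suc u ≡ + 1 +ℤ + u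
+-suc-ℤ u = ℤₚ.pos-+ 1 u

fall-suc : ∀ z d → fall z (suc d) ≡ z *ℤ fall (z -ℤ + 1) d
fall-suc z zero = base z
  where
  base : ∀ z → + 1 *ℤ (z -ℤ + 0) ≡ z *ℤ + 1
  base = solve-∀
fall-suc z (suc d) rewrite fall-suc z d | +-suc-ℤ d = step z (fall (z -ℤ + 1) d) (+ d)
  where
  step : ∀ z X d → z *ℤ X *ℤ (z -ℤ (+ 1 +ℤ d)) ≡ z *ℤ (X *ℤ (z -ℤ + 1 -ℤ d))
  step = solve-∀

-- Think of inserting elements one by one into a set
-- partition that currently has u blocks; the element with weight m may not
-- join m of the blocks.  W ms u d counts the ways of inserting the elements
-- with weights ms so that exactly d new blocks are opened: an element either
-- joins one of the u - m allowed blocks or opens a new block (W⁺).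
mutual
  W : List ℕ → ℕ → ℕ → ℤ
  W []       u zero    = + 1
  W []       u (suc d) = + 0
  W (m ∷ ms) u d       = (+ u -ℤ + m) *ℤ W ms u d +ℤ W⁺ ms u d

  W⁺ : List ℕ → ℕ → ℕ → ℤ
  W⁺ ms u zero    = + 0
  W⁺ ms u (suc d) = W ms (suc u) d

-- At most one new block per element.
W-vanishes : ∀ ms u d → length ms < d → W ms u d ≡ + 0
W-vanishes []       u (suc d) _ = refl
W-vanishes (m ∷ ms) u (suc d) (s≤s ℓ<d)
  rewrite W-vanishes ms u (suc d) (ℕₚ.m<n⇒m<1+n ℓ<d) | W-vanishes ms (suc u) d ℓ<d =
  ≡-trans (ℤₚ.+-identityʳ _) (ℤₚ.*-zeroʳ (+ u -ℤ + m))

-- The expansion  Σ_d W ms u d · (z)_d = ∏_{m ∈ ms} (z + u - m) :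
-- splitting according to the fate of the first element, the "join" terms
-- give (u - m)·∏ and the "new block" terms give z·∏ via (z)_{d+1} = z (z-1)_d.
W-expansion : ∀ ms u z →
  sumTo (length ms) (λ d → W ms u d *ℤ fall z d) ≡ prodL ms (λ m → z +ℤ + u -ℤ + m)
W-expansion []       u z = refl
W-expansion (m ∷ ms) u z = begin
    sumTo (suc ℓ) (λ d → W (m ∷ ms) u d *ℤ fall z d)
  ≡⟨ sumTo-cong (suc ℓ) (λ d → ℤₚ.*-distribʳ-+ (fall z d) ((+ u -ℤ + m) *ℤ W ms u d) (W⁺ ms u d)) ⟩
    sumTo (suc ℓ) (λ d → (+ u -ℤ + m) *ℤ W ms u d *ℤ fall z d +ℤ W⁺ ms u d *ℤ fall z d)
  ≡⟨ sumTo-+ (suc ℓ) _ _ ⟩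
    sumTo (suc ℓ) (λ d → (+ u -ℤ + m) *ℤ W ms u d *ℤ fall z d) +ℤ sumTo (suc ℓ) (λ d → W⁺ ms u d *ℤ fall z d)
  ≡⟨ cong₂ _+ℤ_ joins news ⟩
    (+ u -ℤ + m) *ℤ P +ℤ z *ℤ P
  ≡⟨ collect (+ u) (+ m) z P ⟩
    (z +ℤ + u -ℤ + m) *ℤ P ∎
  where
  open ≡-Reasoning
  ℓ : ℕ
  ℓ = length ms
  P : ℤ
  P = prodL ms (λ m → z +ℤ + u -ℤ + m)
  collect : ∀ u m z P → (u -ℤ m) *ℤ P +ℤ z *ℤ P ≡ (z +ℤ u -ℤ m) *ℤ P
  collect = solve-∀
  shift-arg : (z -ℤ + 1) +ℤ + suc u ≡ z +ℤ + u
  shift-arg rewrite +-suc-ℤ u = cancel z (+ u)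
    where
    cancel : ∀ z u → (z -ℤ + 1) +ℤ (+ 1 +ℤ u) ≡ z +ℤ u
    cancel = solve-∀
  joins : sumTo (suc ℓ) (λ d → (+ u -ℤ + m) *ℤ W ms u d *ℤ fall z d) ≡ (+ u -ℤ + m) *ℤ P
  joins = begin
      sumTo (suc ℓ) (λ d → (+ u -ℤ + m) *ℤ W ms u d *ℤ fall z d)
    ≡⟨ sumTo-cong (suc ℓ) (λ d → ℤₚ.*-assoc (+ u -ℤ + m) _ _) ⟩
      sumTo (suc ℓ) (λ d → (+ u -ℤ + m) *ℤ (W ms u d *ℤ fall z d))
    ≡⟨ sumTo-*ˡ (suc ℓ) (+ u -ℤ + m) _ ⟩
      (+ u -ℤ + m) *ℤ (sumTo ℓ (λ d → W ms u d *ℤ fall z d) +ℤ W ms u (suc ℓ) *ℤ fall z (suc ℓ))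
    ≡⟨ cong (λ t → (+ u -ℤ + m) *ℤ (sumTo ℓ (λ d → W ms u d *ℤ fall z d) +ℤ t *ℤ fall z (suc ℓ)))
            (W-vanishes ms u (suc ℓ) ℕₚ.≤-refl) ⟩
      (+ u -ℤ + m) *ℤ (sumTo ℓ (λ d → W ms u d *ℤ fall z d) +ℤ + 0)
    ≡⟨ cong ((+ u -ℤ + m) *ℤ_) (≡-trans (ℤₚ.+-identityʳ _) (W-expansion ms u z)) ⟩
      (+ u -ℤ + m) *ℤ P ∎
  news : sumTo (suc ℓ) (λ d → W⁺ ms u d *ℤ fall z d) ≡ z *ℤ P
  news = begin
      sumTo (suc ℓ) (λ d → W⁺ ms u d *ℤ fall z d)
    ≡⟨ sumTo-shift ℓ _ ⟩
      + 0 +ℤ sumTo ℓ (λ d → W ms (suc u) d *ℤ fall z (suc d))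
    ≡⟨ ℤₚ.+-identityˡ _ ⟩
      sumTo ℓ (λ d → W ms (suc u) d *ℤ fall z (suc d))
    ≡⟨ sumTo-cong ℓ (λ d → cong (W ms (suc u) d *ℤ_) (fall-suc z d)) ⟩
      sumTo ℓ (λ d → W ms (suc u) d *ℤ (z *ℤ fall (z -ℤ + 1) d))
    ≡⟨ sumTo-cong ℓ (λ d → pull (W ms (suc u) d) z (fall (z -ℤ + 1) d)) ⟩
      sumTo ℓ (λ d → z *ℤ (W ms (suc u) d *ℤ fall (z -ℤ + 1) d))
    ≡⟨ sumTo-*ˡ ℓ z _ ⟩
      z *ℤ sumTo ℓ (λ d → W ms (suc u) d *ℤ fall (z -ℤ + 1) d)
    ≡⟨ cong (z *ℤ_) (W-expansion ms (suc u) (z -ℤ + 1)) ⟩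
      z *ℤ prodL ms (λ m → (z -ℤ + 1) +ℤ + suc u -ℤ + m)
    ≡⟨ cong (λ y → z *ℤ prodL ms (λ m → y -ℤ + m)) shift-arg ⟩
      z *ℤ P ∎
    where
    pull : ∀ A z B → A *ℤ (z *ℤ B) ≡ z *ℤ (A *ℤ B)
    pull = solve-∀

W-swap : ∀ a b ms u d → W (a ∷ b ∷ ms) u d ≡ W (b ∷ a ∷ ms) u d
W-swap a b ms u zero = sym-prod (+ u) (+ a) (+ b) (W ms u zero)
  where
  sym-prod : ∀ u a b X → (u -ℤ a) *ℤ ((u -ℤ b) *ℤ X +ℤ + 0) +ℤ + 0
                       ≡ (u -ℤ b) *ℤ ((u -ℤ a) *ℤ X +ℤ + 0) +ℤ + 0
  sym-prod = solve-∀
W-swap a b ms u (suc d) rewrite +-suc-ℤ u =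
  sym-step (+ u) (+ a) (+ b) (W ms u (suc d)) (W ms (suc u) d) (W⁺ ms (suc u) d)
  where
  sym-step : ∀ u a b X Y Z → (u -ℤ a) *ℤ ((u -ℤ b) *ℤ X +ℤ Y) +ℤ ((+ 1 +ℤ u -ℤ b) *ℤ Y +ℤ Z)
                           ≡ (u -ℤ b) *ℤ ((u -ℤ a) *ℤ X +ℤ Y) +ℤ ((+ 1 +ℤ u -ℤ a) *ℤ Y +ℤ Z)
  sym-step = solve-∀

W-cons-cong : ∀ x {xs ys} → (∀ u d → W xs u d ≡ W ys u d) → ∀ u d → W (x ∷ xs) u d ≡ W (x ∷ ys) u d
W-cons-cong x eq u zero    = cong (λ t → (+ u -ℤ + x) *ℤ t +ℤ + 0) (eq u zero)
W-cons-cong x eq u (suc d) = cong₂ (λ s t → (+ u -ℤ + x) *ℤ s +ℤ t) (eq u (suc d)) (eq (suc u) d)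

W-perm : ∀ {xs ys} → xs ↭ ys → ∀ u d → W xs u d ≡ W ys u d
W-perm refl         = λ u d → refl
W-perm (prep x p)   = W-cons-cong x (W-perm p)
W-perm (swap x y p) = λ u d → ≡-trans (W-swap x y _ u d) (W-cons-cong y (W-cons-cong x (W-perm p)) u d)
W-perm (trans p q)  = λ u d → ≡-trans (W-perm p u d) (W-perm q u d)

range : ℕ → ℕ → List ℕ
range u zero    = []
range u (suc s) = u ∷ range (suc u) s

-- An element of weight u inserted into u blocks must open a new one; so a
-- leading run  u, u+1, …, u+s-1  of weights just opens s new blocks.
W-range : ∀ s u xs d → W (range u s ++ xs) u (s + d) ≡ W xs (s + u) d
W-range zero    u xs d = refl
W-range (suc s) u xs d = begin
    (+ u -ℤ + u) *ℤ W (range (suc u) s ++ xs) u (suc (s + d)) +ℤ W (range (suc u) s ++ xs) (suc u) (s + d)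
  ≡⟨ cong (λ c → c *ℤ W (range (suc u) s ++ xs) u (suc (s + d)) +ℤ W (range (suc u) s ++ xs) (suc u) (s + d))
          (ℤₚ.+-inverseʳ (+ u)) ⟩
    + 0 *ℤ W (range (suc u) s ++ xs) u (suc (s + d)) +ℤ W (range (suc u) s ++ xs) (suc u) (s + d)
  ≡⟨ ℤₚ.+-identityˡ _ ⟩
    W (range (suc u) s ++ xs) (suc u) (s + d)
  ≡⟨ W-range s (suc u) xs d ⟩
    W xs (s + suc u) d
  ≡⟨ cong (λ v → W xs v d) (ℕₚ.+-suc s u) ⟩
    W xs (suc s + u) d ∎
  where open ≡-Reasoning

SameR-sym : ∀ rs {a b} → SameR rs a b → SameR rs b a
SameR-sym (r ∷ rs) (inj₁ (a<r , b<r))       = inj₁ (b<r , a<r)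
SameR-sym (r ∷ rs) (inj₂ (r≤a , r≤b , same)) = inj₂ (r≤b , r≤a , SameR-sym rs same)

SameR-trans : ∀ rs {a b c} → SameR rs a b → SameR rs b c → SameR rs a c
SameR-trans (r ∷ rs) (inj₁ (a<r , _))     (inj₁ (_ , c<r))         = inj₁ (a<r , c<r)
SameR-trans (r ∷ rs) (inj₁ (_ , b<r))     (inj₂ (r≤b , _))         = ⊥-elim (ℕₚ.<⇒≱ b<r r≤b)
SameR-trans (r ∷ rs) (inj₂ (_ , r≤b , _)) (inj₁ (b<r , _))         = ⊥-elim (ℕₚ.<⇒≱ b<r r≤b)
SameR-trans (r ∷ rs) (inj₂ (r≤a , _ , ab)) (inj₂ (_ , r≤c , bc))   = inj₂ (r≤a , r≤c , SameR-trans rs ab bc)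

-- rank rs i : the number of elements of i's distinguished set that precede i
-- (0 if i lies in no distinguished set).
rank : List ℕ → ℕ → ℕ
rank []       i = 0
rank (r ∷ rs) i with i <? r
... | yes _ = i
... | no  _ = rank rs (i ∸ r)

rank-≤ : ∀ rs i → rank rs i ≤ i
rank-≤ []       i = z≤n
rank-≤ (r ∷ rs) i with i <? r
... | yes _ = ℕₚ.≤-refl
... | no  _ = ℕₚ.≤-trans (rank-≤ rs (i ∸ r)) (ℕₚ.m∸n≤m i r)

start-shift : ∀ r L m → r ≤ L → m ≤ L ∸ r → L ∸ m ≡ r + ((L ∸ r) ∸ m)
start-shift r L m r≤L m≤ = ≡-trans (cong (_∸ m) (sym (ℕₚ.m+[n∸m]≡n r≤L))) (ℕₚ.+-∸-assoc r m≤)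

group-start : ∀ rs {i L} → i < L → SameR rs i L → L ∸ rank rs L ≤ i
group-start (r ∷ rs) {i} {L} i<L same with L <? r
group-start (r ∷ rs) {i} {L} i<L same                       | yes _ = subst (_≤ i) (sym (ℕₚ.n∸n≡0 L)) z≤n
group-start (r ∷ rs) {i} {L} i<L (inj₁ (_ , L<r))           | no L≮r = ⊥-elim (L≮r L<r)
group-start (r ∷ rs) {i} {L} i<L (inj₂ (r≤i , r≤L , same)) | no _ =
  subst (_≤ i) (sym (start-shift r L _ r≤L (rank-≤ rs (L ∸ r))))
    (subst (r + _ ≤_) (ℕₚ.m+[n∸m]≡n r≤i)
      (ℕₚ.+-monoʳ-≤ r (group-start rs (ℕₚ.∸-monoˡ-< i<L r≤i) same)))

group-member : ∀ rs {i L} → i < L → L ∸ rank rs L ≤ i → SameR rs i L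
group-member []       i<L start≤i = ⊥-elim (ℕₚ.<⇒≱ i<L start≤i)
group-member (r ∷ rs) {i} {L} i<L start≤i with L <? r
... | yes L<r = inj₁ (ℕₚ.<-trans i<L L<r , L<r)
... | no L≮r = inj₂ (r≤i , r≤L , group-member rs (ℕₚ.∸-monoˡ-< i<L r≤i) rest≤)
  where
  r≤L : r ≤ L
  r≤L = ℕₚ.≮⇒≥ L≮r
  r+rest≤i : r + ((L ∸ r) ∸ rank rs (L ∸ r)) ≤ i
  r+rest≤i = subst (_≤ i) (start-shift r L _ r≤L (rank-≤ rs (L ∸ r))) start≤i
  r≤i : r ≤ i
  r≤i = ℕₚ.≤-trans (ℕₚ.m≤m+n r _) r+rest≤i
  rest≤ : (L ∸ r) ∸ rank rs (L ∸ r) ≤ i ∸ r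
  rest≤ = subst (_≤ i ∸ r) (ℕₚ.m+n∸m≡n r _) (ℕₚ.∸-monoˡ-≤ r r+rest≤i)

ranks : List ℕ → ℕ → ℕ → List ℕ
ranks rs L zero    = []
ranks rs L (suc M) = rank rs L ∷ ranks rs (suc L) M

-- The weight list of the first |rs| + n positions: the ranks run through
-- 0, …, r-1 on each distinguished set of size r, then are 0 on the n others.
runs : List ℕ → ℕ → List ℕ
runs []       n = replicate n 0
runs (r ∷ rs) n = range 0 r ++ runs rs n

ranks-++ : ∀ rs L a b → ranks rs L (a + b) ≡ ranks rs L a ++ ranks rs (L + a) b
ranks-++ rs L zero    b rewrite ℕₚ.+-identityʳ L = refl
ranks-++ rs L (suc a) b rewrite ranks-++ rs (suc L) a b | ℕₚ.+-suc L a = refl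

ranks-outside : ∀ L M → ranks [] L M ≡ replicate M 0
ranks-outside L zero    = refl
ranks-outside L (suc M) = cong (0 ∷_) (ranks-outside (suc L) M)

ranks-first : ∀ r rs L M → L + M ≤ r → ranks (r ∷ rs) L M ≡ range L M
ranks-first r rs L zero    _ = refl
ranks-first r rs L (suc M) L+M<r with L <? r
... | yes _ = cong (L ∷_) (ranks-first r rs (suc L) M (subst (_≤ r) (ℕₚ.+-suc L M) L+M<r))
... | no L≮r = ⊥-elim (L≮r (ℕₚ.≤-trans (s≤s (ℕₚ.m≤m+n L M)) (subst (_≤ r) (ℕₚ.+-suc L M) L+M<r)))

ranks-later : ∀ r rs L M → ranks (r ∷ rs) (r + L) M ≡ ranks rs L M
ranks-later r rs L zero = refl
ranks-later r rs L (suc M) with r + L <? r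
... | yes r+L<r = ⊥-elim (ℕₚ.<⇒≱ r+L<r (ℕₚ.m≤m+n r L))
... | no _ = cong₂ _∷_ (cong (rank rs) (ℕₚ.m+n∸m≡n r L))
                       (≡-trans (cong (λ t → ranks (r ∷ rs) t M) (sym (ℕₚ.+-suc r L))) (ranks-later r rs (suc L) M))

ranks-runs : ∀ rs n → ranks rs 0 (sum rs + n) ≡ runs rs n
ranks-runs []       n = ranks-outside 0 n
ranks-runs (r ∷ rs) n = begin
    ranks (r ∷ rs) 0 (r + sum rs + n)
  ≡⟨ cong (ranks (r ∷ rs) 0) (ℕₚ.+-assoc r (sum rs) n) ⟩
    ranks (r ∷ rs) 0 (r + (sum rs + n))
  ≡⟨ ranks-++ (r ∷ rs) 0 r (sum rs + n) ⟩
    ranks (r ∷ rs) 0 r ++ ranks (r ∷ rs) r (sum rs + n)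
  ≡⟨ cong₂ _++_ (ranks-first r rs 0 r ℕₚ.≤-refl)
                (≡-trans (cong (λ t → ranks (r ∷ rs) t (sum rs + n)) (sym (ℕₚ.+-identityʳ r)))
                         (ranks-later r rs 0 (sum rs + n))) ⟩
    range 0 r ++ ranks rs 0 (sum rs + n)
  ≡⟨ cong (range 0 r ++_) (ranks-runs rs n) ⟩
    range 0 r ++ runs rs n ∎
  where open ≡-Reasoning

runs-∷ʳ : ∀ rs rp n → runs (rs ∷ʳ rp) n ↭ range 0 rp ++ runs rs n
runs-∷ʳ []       rp n = refl
runs-∷ʳ (r ∷ rs) rp n = trans (↭ₚ.++⁺ˡ (range 0 r) (runs-∷ʳ rs rp n)) (↭ₚ.shifts (range 0 r) (range 0 rp))

length-range : ∀ s n → length (range s n) ≡ n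
length-range s zero    = refl
length-range s (suc n) = cong suc (length-range (suc s) n)

length-runs : ∀ rs n → length (runs rs n) ≡ sum rs + n
length-runs []       n = Listₚ.length-replicate n
length-runs (r ∷ rs) n =
  ≡-trans (Listₚ.length-++ (range 0 r))
    (≡-trans (cong₂ _+_ (length-range 0 r) (length-runs rs n)) (sym (ℕₚ.+-assoc r _ n)))

prodL-range : ∀ r s y → prodL (range s r) (λ m → y -ℤ + m) ≡ fall (y -ℤ + s) r
prodL-range zero    s y = refl
prodL-range (suc r) s y rewrite prodL-range r (suc s) y | fall-suc (y -ℤ + s) r =
  cong (λ t → (y -ℤ + s) *ℤ fall t r) (≡-trans (cong (y -ℤ_) (+-suc-ℤ s)) (split y (+ s)))
  where
  split : ∀ y s → y -ℤ (+ 1 +ℤ s) ≡ y -ℤ s -ℤ + 1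
  split = solve-∀

prodL-zeros : ∀ n y → prodL (replicate n 0) (λ m → y -ℤ + m) ≡ y ^ℤ n
prodL-zeros zero    y = refl
prodL-zeros (suc n) y rewrite prodL-zeros n y | ℤₚ.+-identityʳ y = refl

prodL-runs : ∀ rs n y → prodL (runs rs n) (λ m → y -ℤ + m) ≡ prodL rs (fall y) *ℤ y ^ℤ n
prodL-runs []       n y = ≡-trans (prodL-zeros n y) (sym (ℤₚ.*-identityˡ _))
prodL-runs (r ∷ rs) n y
  rewrite prodL-++ (range 0 r) (runs rs n) (λ m → y -ℤ + m) | prodL-runs rs n y | prodL-range r 0 y | ℤₚ.+-identityʳ y =
  sym (ℤₚ.*-assoc (fall y r) _ _)

𝟙 : ∀ {P : Set} → Dec P → ℕ
𝟙 (yes _) = 1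
𝟙 (no  _) = 0

𝟙-yes : ∀ {P : Set} (P? : Dec P) → P → 𝟙 P? ≡ 1
𝟙-yes (yes _) _ = refl
𝟙-yes (no ¬p) p = ⊥-elim (¬p p)

𝟙-no : ∀ {P : Set} (P? : Dec P) → ¬ P → 𝟙 P? ≡ 0
𝟙-no (yes p) ¬p = ⊥-elim (¬p p)
𝟙-no (no _)  _  = refl

𝟙-⇔ : ∀ {P Q : Set} → (P → Q) → (Q → P) → (P? : Dec P) (Q? : Dec Q) → 𝟙 P? ≡ 𝟙 Q?
𝟙-⇔ to from P? (yes q) = 𝟙-yes P? (from q)
𝟙-⇔ to from P? (no ¬q) = 𝟙-no P? (λ p → ¬q (to p))

ΣL : ∀ {A : Set} → List A → (A → ℕ) → ℕ
ΣL xs f = sum (map f xs)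

ΣL-cong : ∀ {A : Set} (xs : List A) {f g : A → ℕ} → (∀ x → f x ≡ g x) → ΣL xs f ≡ ΣL xs g
ΣL-cong []       f≗g = refl
ΣL-cong (x ∷ xs) f≗g = cong₂ _+_ (f≗g x) (ΣL-cong xs f≗g)

ΣL-+ : ∀ {A : Set} (xs : List A) (f g : A → ℕ) → ΣL xs (λ x → f x + g x) ≡ ΣL xs f + ΣL xs g
ΣL-+ []       f g = refl
ΣL-+ (x ∷ xs) f g rewrite ΣL-+ xs f g = +-interchange (f x) (g x) (ΣL xs f) (ΣL xs g)

ΣL-0 : ∀ {A : Set} (xs : List A) → ΣL xs (λ _ → 0) ≡ 0
ΣL-0 []       = refl
ΣL-0 (x ∷ xs) = ΣL-0 xs

ΣL-swap : ∀ {A B : Set} (xs : List A) (ys : List B) (f : A → B → ℕ) →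
  ΣL xs (λ x → ΣL ys (f x)) ≡ ΣL ys (λ y → ΣL xs (λ x → f x y))
ΣL-swap []       ys f = sym (ΣL-0 ys)
ΣL-swap (x ∷ xs) ys f rewrite ΣL-swap xs ys f = sym (ΣL-+ ys (f x) (λ y → ΣL xs (λ x → f x y)))

ΣL-map : ∀ {A B : Set} (h : A → B) (xs : List A) (f : B → ℕ) → ΣL (map h xs) f ≡ ΣL xs (λ x → f (h x))
ΣL-map h []       f = refl
ΣL-map h (x ∷ xs) f = cong (λ s → f (h x) + s) (ΣL-map h xs f)

ΣL-concatMap : ∀ {A B : Set} (g : A → List B) (xs : List A) (f : B → ℕ) →
  ΣL (concatMap g xs) f ≡ ΣL xs (λ x → ΣL (g x) f)
ΣL-concatMap g []       f = refl
ΣL-concatMap g (x ∷ xs) f = begin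
    sum (map f (g x ++ concatMap g xs))
  ≡⟨ cong sum (Listₚ.map-++ f (g x) (concatMap g xs)) ⟩
    sum (map f (g x) ++ map f (concatMap g xs))
  ≡⟨ ListActionₚ.sum-++ (map f (g x)) _ ⟩
    ΣL (g x) f + ΣL (concatMap g xs) f
  ≡⟨ cong (λ s → ΣL (g x) f + s) (ΣL-concatMap g xs f) ⟩
    ΣL (g x) f + ΣL xs (λ x → ΣL (g x) f) ∎
  where
  open ≡-Reasoning

length-filter : ∀ {A : Set} {P : A → Set} (P? : Decidable P) xs → length (filter P? xs) ≡ ΣL xs (λ x → 𝟙 (P? x))
length-filter P? []       = refl
length-filter P? (x ∷ xs) with P? x
... | yes _ = cong suc (length-filter P? xs)
... | no  _ = length-filter P? xs

Σ< : ℕ → (ℕ → ℕ) → ℕ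
Σ< zero    f = 0
Σ< (suc n) f = f 0 + Σ< n (λ j → f (suc j))

ΣL-allFin : ∀ n (f : ℕ → ℕ) → ΣL (allFin n) (λ j → f (toℕ j)) ≡ Σ< n f
ΣL-allFin n f = ≡-trans (cong sum (Listₚ.map-tabulate {n = n} (λ j → j) (λ j → f (toℕ j)))) (tabulated n f)
  where
  tabulated : ∀ n (f : ℕ → ℕ) → sum (tabulate (λ (j : Fin n) → f (toℕ j))) ≡ Σ< n f
  tabulated zero    f = refl
  tabulated (suc n) f = cong (λ s → f 0 + s) (tabulated n (λ j → f (suc j)))

Σ<-cong : ∀ n {f g : ℕ → ℕ} → (∀ {j} → j < n → f j ≡ g j) → Σ< n f ≡ Σ< n g
Σ<-cong zero    f≗g = refl
Σ<-cong (suc n) f≗g = cong₂ _+_ (f≗g (s≤s z≤n)) (Σ<-cong n (λ j<n → f≗g (s≤s j<n)))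

Σ<-0 : ∀ n {f : ℕ → ℕ} → (∀ {j} → j < n → f j ≡ 0) → Σ< n f ≡ 0
Σ<-0 zero    f≗0 = refl
Σ<-0 (suc n) f≗0 = cong₂ _+_ (f≗0 (s≤s z≤n)) (Σ<-0 n (λ j<n → f≗0 (s≤s j<n)))

Σ<-+ : ∀ n (f g : ℕ → ℕ) → Σ< n (λ j → f j + g j) ≡ Σ< n f + Σ< n g
Σ<-+ zero    f g = refl
Σ<-+ (suc n) f g rewrite Σ<-+ n (λ j → f (suc j)) (λ j → g (suc j)) =
  +-interchange (f 0) (g 0) (Σ< n (λ j → f (suc j))) (Σ< n (λ j → g (suc j)))

Σ<-truncate : ∀ {u n} (f : ℕ → ℕ) → u ≤ n → (∀ {j} → u ≤ j → f j ≡ 0) → Σ< n f ≡ Σ< u f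
Σ<-truncate {zero}  {n}     f _         f≗0 = Σ<-0 n (λ _ → f≗0 z≤n)
Σ<-truncate {suc u} {suc n} f (s≤s u≤n) f≗0 =
  cong (λ s → f 0 + s) (Σ<-truncate (λ j → f (suc j)) u≤n (λ u≤j → f≗0 (s≤s u≤j)))

Σ<-point : ∀ {v n} → v < n → Σ< n (λ j → 𝟙 (j ≟ v)) ≡ 1
Σ<-point {zero}  {suc n} _ = cong₂ _+_ (𝟙-yes (0 ≟ 0) refl) (Σ<-0 n (λ {j} _ → 𝟙-no (suc j ≟ 0) (λ ())))
Σ<-point {suc v} {suc n} (s≤s v<n) = begin
    𝟙 (0 ≟ suc v) + Σ< n (λ j → 𝟙 (suc j ≟ suc v))
  ≡⟨ cong₂ _+_ (𝟙-no (0 ≟ suc v) (λ ()))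
               (Σ<-cong n (λ {j} _ → 𝟙-⇔ ℕₚ.suc-injective (cong suc) (suc j ≟ suc v) (j ≟ v))) ⟩
    Σ< n (λ j → 𝟙 (j ≟ v))
  ≡⟨ Σ<-point v<n ⟩
    1 ∎
  where open ≡-Reasoning

Σ<-linear : ∀ n (C f g : ℕ → ℕ) X Y → (∀ j → + C j ≡ + f j *ℤ X +ℤ + g j *ℤ Y) →
  + Σ< n C ≡ + Σ< n f *ℤ X +ℤ + Σ< n g *ℤ Y
Σ<-linear zero C f g X Y _ = sym (vanish X Y)
  where
  vanish : ∀ X Y → + 0 *ℤ X +ℤ + 0 *ℤ Y ≡ + 0
  vanish = solve-∀
Σ<-linear (suc n) C f g X Y C≡ = begin
    + (C 0 + Σ< n C′)
  ≡⟨ ℤₚ.pos-+ (C 0) (Σ< n C′) ⟩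
    + C 0 +ℤ + Σ< n C′
  ≡⟨ cong₂ _+ℤ_ (C≡ 0) (Σ<-linear n C′ f′ g′ X Y (λ j → C≡ (suc j))) ⟩
    (+ f 0 *ℤ X +ℤ + g 0 *ℤ Y) +ℤ (+ Σ< n f′ *ℤ X +ℤ + Σ< n g′ *ℤ Y)
  ≡⟨ regroup (+ f 0) (+ g 0) (+ Σ< n f′) (+ Σ< n g′) X Y ⟩
    (+ f 0 +ℤ + Σ< n f′) *ℤ X +ℤ (+ g 0 +ℤ + Σ< n g′) *ℤ Y
  ≡⟨ sym (cong₂ (λ a b → a *ℤ X +ℤ b *ℤ Y) (ℤₚ.pos-+ (f 0) (Σ< n f′)) (ℤₚ.pos-+ (g 0) (Σ< n g′))) ⟩
    + (f 0 + Σ< n f′) *ℤ X +ℤ + (g 0 + Σ< n g′) *ℤ Y ∎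
  where
  open ≡-Reasoning
  C′ f′ g′ : ℕ → ℕ
  C′ j = C (suc j)
  f′ j = f (suc j)
  g′ j = g (suc j)
  regroup : ∀ a b c d X Y → (a *ℤ X +ℤ b *ℤ Y) +ℤ (c *ℤ X +ℤ d *ℤ Y) ≡ (a +ℤ c) *ℤ X +ℤ (b +ℤ d) *ℤ Y
  regroup = solve-∀

-- A labelling Fin M → Fin k read as a sequence of naturals (0 beyond M).
seq : ∀ {M k} → (Fin M → Fin k) → ℕ → ℕ
seq {zero}  g i       = 0
seq {suc M} g zero    = toℕ (g Fin.zero)
seq {suc M} g (suc i) = seq (λ x → g (Fin.suc x)) i

_◂_ : ℕ → (ℕ → ℕ) → ℕ → ℕ
(j ◂ e) zero    = j
(j ◂ e) (suc i) = e i

Extensional : ((ℕ → ℕ) → Set) → Set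
Extensional Q = ∀ {e e′} → (∀ i → e i ≡ e′ i) → Q e → Q e′

count : ∀ M k {Q : (ℕ → ℕ) → Set} → ((e : ℕ → ℕ) → Dec (Q e)) → ℕ
count M k Q? = length (filter (λ g → Q? (seq g)) (allFuns M k))

count-zero : ∀ k {Q : (ℕ → ℕ) → Set} (Q? : (e : ℕ → ℕ) → Dec (Q e)) → count 0 k Q? ≡ 𝟙 (Q? (λ _ → 0))
count-zero k Q? with Q? (λ _ → 0)
... | yes _ = refl
... | no  _ = refl

count-⇔ : ∀ M k {Q Q′ : (ℕ → ℕ) → Set} (Q? : (e : ℕ → ℕ) → Dec (Q e)) (Q′? : (e : ℕ → ℕ) → Dec (Q′ e)) →
  (∀ {e} → Q e → Q′ e) → (∀ {e} → Q′ e → Q e) → count M k Q? ≡ count M k Q′?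
count-⇔ M k Q? Q′? to from = begin
    length (filter (λ g → Q? (seq g)) (allFuns M k))
  ≡⟨ length-filter _ (allFuns M k) ⟩
    ΣL (allFuns M k) (λ g → 𝟙 (Q? (seq g)))
  ≡⟨ ΣL-cong (allFuns M k) (λ g → 𝟙-⇔ to from (Q? (seq g)) (Q′? (seq g))) ⟩
    ΣL (allFuns M k) (λ g → 𝟙 (Q′? (seq g)))
  ≡⟨ sym (length-filter _ (allFuns M k)) ⟩
    length (filter (λ g → Q′? (seq g)) (allFuns M k)) ∎
  where open ≡-Reasoning

count-none : ∀ M k {Q : (ℕ → ℕ) → Set} (Q? : (e : ℕ → ℕ) → Dec (Q e)) → (∀ e → ¬ Q e) → count M k Q? ≡ 0
count-none M k Q? none = begin
    length (filter (λ g → Q? (seq g)) (allFuns M k))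
  ≡⟨ length-filter _ (allFuns M k) ⟩
    ΣL (allFuns M k) (λ g → 𝟙 (Q? (seq g)))
  ≡⟨ ΣL-cong (allFuns M k) (λ g → 𝟙-no (Q? (seq g)) (none (seq g))) ⟩
    ΣL (allFuns M k) (λ _ → 0)
  ≡⟨ ΣL-0 (allFuns M k) ⟩
    0 ∎
  where open ≡-Reasoning

count-suc : ∀ M k {Q : (ℕ → ℕ) → Set} (Q? : (e : ℕ → ℕ) → Dec (Q e)) → Extensional Q →
  count (suc M) k Q? ≡ Σ< k (λ j → count M k (λ e → Q? (j ◂ e)))
count-suc M k {Q} Q? ext = begin
    length (filter (λ g → Q? (seq g)) (allFuns (suc M) k))
  ≡⟨ length-filter _ (allFuns (suc M) k) ⟩
    ΣL (allFuns (suc M) k) (λ g → 𝟙 (Q? (seq g)))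
  ≡⟨ ΣL-concatMap _ (allFuns M k) _ ⟩
    ΣL (allFuns M k) (λ g → ΣL (map _ (allFin k)) (λ h → 𝟙 (Q? (seq h))))
  ≡⟨ ΣL-cong (allFuns M k) (λ g → ≡-trans (ΣL-map _ (allFin k) _) (ΣL-cong (allFin k) (λ j → first-label _))) ⟩
    ΣL (allFuns M k) (λ g → ΣL (allFin k) (λ j → 𝟙 (Q? (toℕ j ◂ seq g))))
  ≡⟨ ΣL-swap (allFuns M k) (allFin k) _ ⟩
    ΣL (allFin k) (λ j → ΣL (allFuns M k) (λ g → 𝟙 (Q? (toℕ j ◂ seq g))))
  ≡⟨ ΣL-cong (allFin k) (λ j → sym (length-filter _ (allFuns M k))) ⟩
    ΣL (allFin k) (λ j → count M k (λ e → Q? (toℕ j ◂ e)))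
  ≡⟨ ΣL-allFin k (λ j → count M k (λ e → Q? (j ◂ e))) ⟩
    Σ< k (λ j → count M k (λ e → Q? (j ◂ e))) ∎
  where
  open ≡-Reasoning
  first-label : ∀ (h : Fin (suc M) → Fin k) →
    𝟙 (Q? (seq h)) ≡ 𝟙 (Q? (toℕ (h Fin.zero) ◂ seq (λ x → h (Fin.suc x))))
  first-label h = 𝟙-⇔ (ext same) (ext (λ i → sym (same i))) (Q? _) (Q? _)
    where
    same : ∀ i → seq h i ≡ (toℕ (h Fin.zero) ◂ seq (λ x → h (Fin.suc x))) i
    same zero    = refl
    same (suc i) = refl

glue : (ℕ → ℕ) → ℕ → (ℕ → ℕ) → ℕ → ℕ
glue a L e i with i <? L
... | yes _ = a i
... | no  _ = e (i ∸ L)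

glue-< : ∀ a L e {i} → i < L → glue a L e i ≡ a i
glue-< a L e {i} i<L with i <? L
... | yes _   = refl
... | no  i≮L = ⊥-elim (i≮L i<L)

glue-≮ : ∀ a L e {i} → ¬ i < L → glue a L e i ≡ e (i ∸ L)
glue-≮ a L e {i} i≮L with i <? L
... | yes i<L = ⊥-elim (i≮L i<L)
... | no  _   = refl

glue-cong : ∀ a L {e e′} → (∀ i → e i ≡ e′ i) → ∀ i → glue a L e i ≡ glue a L e′ i
glue-cong a L e≗e′ i with i <? L
... | yes _ = refl
... | no  _ = e≗e′ (i ∸ L)

extend : (ℕ → ℕ) → ℕ → ℕ → ℕ → ℕ
extend a L j = glue a L (λ _ → j)

extend-< : ∀ a L j {i} → i < L → extend a L j i ≡ a i
extend-< a L j = glue-< a L (λ _ → j)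

extend-at : ∀ a L j → extend a L j L ≡ j
extend-at a L j = glue-≮ a L (λ _ → j) (ℕₚ.<-irrefl refl)

glue-◂ : ∀ a L j e i → glue a L (j ◂ e) i ≡ glue (extend a L j) (suc L) e i
glue-◂ a L j e i with ℕₚ.<-cmp i L
... | tri< i<L _ _ = ≡-trans (glue-< a L _ i<L) (sym (≡-trans (glue-< _ (suc L) e (ℕₚ.m<n⇒m<1+n i<L)) (extend-< a L j i<L)))
... | tri≈ _ refl _ = ≡-trans (glue-≮ a L _ (ℕₚ.<-irrefl refl)) (≡-trans (cong (j ◂ e) (ℕₚ.n∸n≡0 i))
                        (sym (≡-trans (glue-< _ (suc L) e (ℕₚ.n<1+n i)) (extend-at a L j))))
... | tri> _ _ L<i = ≡-trans (glue-≮ a L _ (ℕₚ.<⇒≯ L<i)) (≡-trans (cong (j ◂ e) (ℕₚ.+-∸-assoc 1 L<i))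
                        (sym (glue-≮ _ (suc L) e (λ i<1+L → ℕₚ.<⇒≱ L<i (ℕₚ.m<1+n⇒m≤n i<1+L)))))

glue-extend-< : ∀ a L j e {i} → i < L → glue (extend a L j) (suc L) e i ≡ a i
glue-extend-< a L j e i<L = ≡-trans (glue-< (extend a L j) (suc L) e (ℕₚ.m<n⇒m<1+n i<L)) (extend-< a L j i<L)

glue-extend-at : ∀ a L j e → glue (extend a L j) (suc L) e L ≡ j
glue-extend-at a L j e = ≡-trans (glue-< (extend a L j) (suc L) e (ℕₚ.n<1+n L)) (extend-at a L j)

Hit : (ℕ → ℕ) → ℕ → ℕ → ℕ → Set
Hit a s m j = ∃ λ t → t < m × a (s + t) ≡ j

Hit? : ∀ a s m j → Dec (Hit a s m j)
Hit? a s m j = ℕₚ.anyUpTo? (λ t → a (s + t) ≟ j) m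

missed-labels : ∀ a s m u → (∀ {t} → t < m → a (s + t) < u) →
  (∀ {t t′} → t < m → t′ < m → t ≢ t′ → a (s + t) ≢ a (s + t′)) →
  Σ< u (λ j → 𝟙 (¬? (Hit? a s m j))) + m ≡ u
missed-labels a s zero u _ _ =
  ≡-trans (ℕₚ.+-identityʳ _) (≡-trans (Σ<-cong u (λ {j} _ → 𝟙-yes (¬? (Hit? a s 0 j)) (λ ()))) (all-ones u))
  where
  all-ones : ∀ u → Σ< u (λ _ → 1) ≡ u
  all-ones zero    = refl
  all-ones (suc u) = cong suc (all-ones u)
missed-labels a s (suc m) u bounded injective = begin
    Σ< u missed′ + suc m
  ≡⟨ ℕₚ.+-suc _ m ⟩
    suc (Σ< u missed′) + m
  ≡⟨ cong (_+ m) (ℕₚ.+-comm 1 _) ⟩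
    Σ< u missed′ + 1 + m
  ≡⟨ cong (λ c → Σ< u missed′ + c + m) (sym (Σ<-point (bounded last<))) ⟩
    Σ< u missed′ + Σ< u (λ j → 𝟙 (j ≟ v)) + m
  ≡⟨ cong (_+ m) (sym (Σ<-+ u missed′ _)) ⟩
    Σ< u (λ j → missed′ j + 𝟙 (j ≟ v)) + m
  ≡⟨ cong (_+ m) (Σ<-cong u (λ {j} _ → one-more j)) ⟩
    Σ< u missed + m
  ≡⟨ missed-labels a s m u (λ t<m → bounded (ℕₚ.m<n⇒m<1+n t<m))
                          (λ t<m t′<m → injective (ℕₚ.m<n⇒m<1+n t<m) (ℕₚ.m<n⇒m<1+n t′<m)) ⟩
    u ∎
  where
  open ≡-Reasoning
  v : ℕ
  v = a (s + m)
  last< : m < suc m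
  last< = ℕₚ.n<1+n m
  missed missed′ : ℕ → ℕ
  missed  j = 𝟙 (¬? (Hit? a s m j))
  missed′ j = 𝟙 (¬? (Hit? a s (suc m) j))
  v-new : ¬ Hit a s m v
  v-new (t , t<m , eq) = injective (ℕₚ.m<n⇒m<1+n t<m) last< (ℕₚ.<⇒≢ t<m) eq
  one-more : ∀ j → missed′ j + 𝟙 (j ≟ v) ≡ missed j
  one-more j with j ≟ v
  ... | yes refl = ≡-trans (ℕₚ.+-comm _ 1)
                     (≡-trans (cong suc (𝟙-no (¬? (Hit? a s (suc m) v)) (λ missed → missed (m , last< , refl))))
                              (sym (𝟙-yes (¬? (Hit? a s m v)) v-new)))
  ... | no j≢v = ≡-trans (ℕₚ.+-identityʳ _) (𝟙-⇔ shorter longer (¬? (Hit? a s (suc m) j)) (¬? (Hit? a s m j)))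
    where
    shorter : ¬ Hit a s (suc m) j → ¬ Hit a s m j
    shorter ¬hit (t , t<m , eq) = ¬hit (t , ℕₚ.m<n⇒m<1+n t<m , eq)
    longer : ¬ Hit a s m j → ¬ Hit a s (suc m) j
    longer ¬hit (t , t<1+m , eq) with ℕₚ.m<1+n⇒m<n∨m≡n t<1+m
    ... | inj₁ t<m  = ¬hit (t , t<m , eq)
    ... | inj₂ refl = j≢v (sym eq)

record Prefix (rs : List ℕ) (a : ℕ → ℕ) (L u : ℕ) : Set where
  field
    bounded   : ∀ {i} → i < L → a i < u
    onto      : ∀ {j} → j < u → ∃ λ i → i < L × a i ≡ j
    canonical : ∀ {i} → i < L → ∀ {j} → j < a i → ∃ λ i′ → i′ < i × a i′ ≡ j
    separated : ∀ {i} → i < L → ∀ {i′} → i′ < L → i ≢ i′ → SameR rs i i′ → a i ≢ a i′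
open Prefix

Prefix? : ∀ rs a L u → Dec (Prefix rs a L u)
Prefix? rs a L u = map′ (λ (b , o , c , s) → record { bounded = b ; onto = o ; canonical = c ; separated = s })
                       (λ p → (λ {i} → bounded p {i}) , (λ {j} → onto p {j}) ,
                              (λ {i} → canonical p {i}) , (λ {i} → separated p {i}))
  (      ℕₚ.allUpTo? (λ i → suc (a i) ≤? u) L
  ×-dec (ℕₚ.allUpTo? (λ j → ℕₚ.anyUpTo? (λ i → a i ≟ j) L) u
  ×-dec (ℕₚ.allUpTo? (λ i → ℕₚ.allUpTo? (λ j → ℕₚ.anyUpTo? (λ i′ → a i′ ≟ j) i) (a i)) L
  ×-dec  ℕₚ.allUpTo? (λ i → ℕₚ.allUpTo? (λ i′ →
           ¬? (i ≟ i′) →-dec (SameR? rs i i′ →-dec ¬? (a i ≟ a i′))) L) L)))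

Prefix-resp : ∀ {rs a b L u} → (∀ {i} → i < L → a i ≡ b i) → Prefix rs a L u → Prefix rs b L u
Prefix-resp {rs} {a} {b} {L} {u} a≗b p = record
  { bounded   = λ i<L → subst (_< u) (a≗b i<L) (bounded p i<L)
  ; onto      = λ j<u → let (i , i<L , eq) = onto p j<u in i , i<L , ≡-trans (sym (a≗b i<L)) eq
  ; canonical = λ {i} i<L {j} j<bi → let (i′ , i′<i , eq) = canonical p i<L (subst (j <_) (sym (a≗b i<L)) j<bi)
                                    in i′ , i′<i , ≡-trans (sym (a≗b (ℕₚ.<-trans i′<i i<L))) eq
  ; separated = λ i<L i′<L i≢i′ same eq →
                  separated p i<L i′<L i≢i′ same (≡-trans (a≗b i<L) (≡-trans eq (sym (a≗b i′<L))))
  }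

Prefix-unique : ∀ {rs a L u v} → Prefix rs a L u → Prefix rs a L v → u ≡ v
Prefix-unique {u = u} {v} p q with ℕₚ.<-cmp u v
... | tri≈ _ u≡v _ = u≡v
... | tri< u<v _ _ = let (i , i<L , eq) = onto q u<v in ⊥-elim (ℕₚ.<-irrefl eq (bounded p i<L))
... | tri> _ _ v<u = let (i , i<L , eq) = onto p v<u in ⊥-elim (ℕₚ.<-irrefl eq (bounded q i<L))

Prefix-empty : ∀ rs a → Prefix rs a 0 0
Prefix-empty rs a = record { bounded = λ () ; onto = λ () ; canonical = λ () ; separated = λ () }

Prefix-glue : ∀ {rs a L u} e → Prefix rs a L u → Prefix rs (glue a L e) L u
Prefix-glue {a = a} {L} e = Prefix-resp (λ i<L → sym (glue-< a L e i<L))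

Prefix-unglue : ∀ {rs a L u} e → Prefix rs (glue a L e) L u → Prefix rs a L u
Prefix-unglue {a = a} {L} e = Prefix-resp (λ i<L → glue-< a L e i<L)

-- The labels already used in the distinguished set of position L: the
-- earlier members of that set form the window [L - rank L, L).
Clash : List ℕ → (ℕ → ℕ) → ℕ → ℕ → Set
Clash rs a L = Hit a (L ∸ rank rs L) (rank rs L)

window-member : ∀ rs L {t} → t < rank rs L → (L ∸ rank rs L + t < L) × SameR rs (L ∸ rank rs L + t) L
window-member rs L {t} t<m = s+t<L , group-member rs s+t<L (ℕₚ.m≤m+n _ t)
  where
  s+t<L : L ∸ rank rs L + t < L
  s+t<L = subst (L ∸ rank rs L + t <_) (ℕₚ.m∸n+n≡m (rank-≤ rs L)) (ℕₚ.+-monoʳ-< (L ∸ rank rs L) t<m)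

window-offset : ∀ rs {i L} → i < L → SameR rs i L → ∃ λ t → t < rank rs L × L ∸ rank rs L + t ≡ i
window-offset rs {i} {L} i<L same =
  i ∸ s , subst (i ∸ s <_) (ℕₚ.m∸[m∸n]≡n (rank-≤ rs L)) (ℕₚ.∸-monoˡ-< i<L s≤i) , ℕₚ.m+[n∸m]≡n s≤i
  where
  s : ℕ
  s = L ∸ rank rs L
  s≤i : s ≤ i
  s≤i = group-start rs i<L same

no-clash : ∀ {rs a L i j} → ¬ Clash rs a L j → i < L → SameR rs i L → a i ≢ j
no-clash {rs} {a} fresh i<L same ai≡j =
  let (t , t<m , s+t≡i) = window-offset rs i<L same in fresh (t , t<m , ≡-trans (cong a s+t≡i) ai≡j)

extend-canonical : ∀ {rs a L u j} → Prefix rs a L u → j ≤ u →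
  ∀ {i} → i < suc L → ∀ {j′} → j′ < extend a L j i → ∃ λ i′ → i′ < i × extend a L j i′ ≡ j′
extend-canonical {a = a} {L} {u} {j} p j≤u {i} i<1+L {j′} j′<b with ℕₚ.m<1+n⇒m<n∨m≡n i<1+L
... | inj₁ i<L = let (i′ , i′<i , eq) = canonical p i<L (subst (j′ <_) (extend-< a L j i<L) j′<b)
                 in i′ , i′<i , ≡-trans (extend-< a L j (ℕₚ.<-trans i′<i i<L)) eq
... | inj₂ refl = let (i′ , i′<L , eq) = onto p (ℕₚ.<-≤-trans (subst (j′ <_) (extend-at a L j) j′<b) j≤u)
                  in i′ , i′<L , ≡-trans (extend-< a L j i′<L) eq

extend-separated : ∀ {rs a L u j} → Prefix rs a L u → ¬ Clash rs a L j →
  ∀ {i} → i < suc L → ∀ {i′} → i′ < suc L → i ≢ i′ → SameR rs i i′ → extend a L j i ≢ extend a L j i′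
extend-separated {rs} {a} {L} {u} {j} p fresh {i} i<1+L {i′} i′<1+L i≢i′ same eq
  with ℕₚ.m<1+n⇒m<n∨m≡n i<1+L | ℕₚ.m<1+n⇒m<n∨m≡n i′<1+L
... | inj₁ i<L  | inj₁ i′<L = separated p i<L i′<L i≢i′ same
                                (≡-trans (sym (extend-< a L j i<L)) (≡-trans eq (extend-< a L j i′<L)))
... | inj₁ i<L  | inj₂ refl = no-clash {rs} {a} fresh i<L same (≡-trans (sym (extend-< a L j i<L)) (≡-trans eq (extend-at a L j)))
... | inj₂ refl | inj₁ i′<L = no-clash {rs} {a} fresh i′<L (SameR-sym rs same)
                                (≡-trans (sym (extend-< a L j i′<L)) (≡-trans (sym eq) (extend-at a L j)))
... | inj₂ refl | inj₂ refl = i≢i′ refl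

join : ∀ {rs a L u j} → Prefix rs a L u → j < u → ¬ Clash rs a L j → Prefix rs (extend a L j) (suc L) u
join {a = a} {L} {u} {j} p j<u fresh = record
  { bounded   = new-bounded
  ; onto      = λ j′<u → let (i , i<L , eq) = onto p j′<u in i , ℕₚ.m<n⇒m<1+n i<L , ≡-trans (extend-< a L j i<L) eq
  ; canonical = extend-canonical p (ℕₚ.<⇒≤ j<u)
  ; separated = extend-separated p fresh
  }
  where
  new-bounded : ∀ {i} → i < suc L → extend a L j i < u
  new-bounded i<1+L with ℕₚ.m<1+n⇒m<n∨m≡n i<1+L
  ... | inj₁ i<L  = subst (_< u) (sym (extend-< a L j i<L)) (bounded p i<L)
  ... | inj₂ refl = subst (_< u) (sym (extend-at a L j)) j<u

open-block : ∀ {rs a L u} → Prefix rs a L u → Prefix rs (extend a L u) (suc L) (suc u)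
open-block {rs} {a} {L} {u} p = record
  { bounded   = new-bounded
  ; onto      = new-onto
  ; canonical = extend-canonical p ℕₚ.≤-refl
  ; separated = extend-separated p (λ (t , t<m , eq) → ℕₚ.<-irrefl eq (bounded p (proj₁ (window-member rs L t<m))))
  }
  where
  new-bounded : ∀ {i} → i < suc L → extend a L u i < suc u
  new-bounded i<1+L with ℕₚ.m<1+n⇒m<n∨m≡n i<1+L
  ... | inj₁ i<L  = subst (_< suc u) (sym (extend-< a L u i<L)) (ℕₚ.m<n⇒m<1+n (bounded p i<L))
  ... | inj₂ refl = subst (_< suc u) (sym (extend-at a L u)) (ℕₚ.n<1+n u)
  new-onto : ∀ {j} → j < suc u → ∃ λ i → i < suc L × extend a L u i ≡ j
  new-onto j<1+u with ℕₚ.m<1+n⇒m<n∨m≡n j<1+u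
  ... | inj₁ j<u  = let (i , i<L , eq) = onto p j<u in i , ℕₚ.m<n⇒m<1+n i<L , ≡-trans (extend-< a L u i<L) eq
  ... | inj₂ refl = L , ℕₚ.n<1+n L , extend-at a L u

-- Conversely, in any admissible continuation b of a the label at L is at
-- most u (canonicity) and does not clash (separation).
continuation-≤ : ∀ {rs a b L N u v} → Prefix rs a L u → Prefix rs b N v → L < N →
  (∀ {i} → i < L → b i ≡ a i) → ¬ u < b L
continuation-≤ p q L<N b≗a u<bL =
  let (i′ , i′<L , eq) = canonical q L<N u<bL in ℕₚ.<-irrefl (≡-trans (sym (b≗a i′<L)) eq) (bounded p i′<L)

continuation-fresh : ∀ {rs a b L N v} → Prefix rs b N v → L < N →
  (∀ {i} → i < L → b i ≡ a i) → ¬ Clash rs a L (b L)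
continuation-fresh {rs} {a} {b} {L} q L<N b≗a (t , t<m , eq) =
  let (s+t<L , same) = window-member rs L t<m
  in separated q (ℕₚ.<-trans s+t<L L<N) L<N (ℕₚ.<⇒≢ s+t<L) same (≡-trans (b≗a s+t<L) eq)

completions : List ℕ → ℕ → (ℕ → ℕ) → ℕ → ℕ → ℕ
completions rs k a L M = count M k (λ e → Prefix? rs (glue a L e) (L + M) k)

completions-step : ∀ rs k a L M →
  completions rs k a L (suc M) ≡ Σ< k (λ j → completions rs k (extend a L j) (suc L) M)
completions-step rs k a L M = begin
    count (suc M) k (λ e → Prefix? rs (glue a L e) (L + suc M) k)
  ≡⟨ count-suc M k (λ e → Prefix? rs (glue a L e) (L + suc M) k)
                  (λ e≗e′ → Prefix-resp (λ {i} _ → glue-cong a L e≗e′ i)) ⟩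
    Σ< k (λ j → count M k (λ e → Prefix? rs (glue a L (j ◂ e)) (L + suc M) k))
  ≡⟨ Σ<-cong k (λ {j} _ → count-⇔ M k (λ e → Prefix? rs (glue a L (j ◂ e)) (L + suc M) k)
                                       (λ e → Prefix? rs (glue (extend a L j) (suc L) e) (suc L + M) k)
                                       (move j) (move-back j)) ⟩
    Σ< k (λ j → count M k (λ e → Prefix? rs (glue (extend a L j) (suc L) e) (suc L + M) k)) ∎
  where
  open ≡-Reasoning
  move : ∀ j {e} → Prefix rs (glue a L (j ◂ e)) (L + suc M) k → Prefix rs (glue (extend a L j) (suc L) e) (suc L + M) k
  move j {e} p = subst (λ N → Prefix rs (glue (extend a L j) (suc L) e) N k) (ℕₚ.+-suc L M)
                  (Prefix-resp {a = glue a L (j ◂ e)} (λ {i} _ → glue-◂ a L j e i) p)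
  move-back : ∀ j {e} → Prefix rs (glue (extend a L j) (suc L) e) (suc L + M) k → Prefix rs (glue a L (j ◂ e)) (L + suc M) k
  move-back j {e} p = subst (λ N → Prefix rs (glue a L (j ◂ e)) N k) (sym (ℕₚ.+-suc L M))
                       (Prefix-resp {a = glue (extend a L j) (suc L) e} (λ {i} _ → sym (glue-◂ a L j e i)) p)

completions-done : ∀ rs k a L u d → u + d ≡ k → Prefix rs a L u → + completions rs k a L 0 ≡ W [] u d
completions-done rs k a L u zero u+0≡k p =
  cong +_ (≡-trans (count-zero k (λ e → Prefix? rs (glue a L e) (L + 0) k))
                   (𝟙-yes (Prefix? rs _ (L + 0) k) (subst (Prefix rs _ (L + 0)) u≡k finished)))
  where
  u≡k : u ≡ k
  u≡k = ≡-trans (sym (ℕₚ.+-identityʳ u)) u+0≡k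
  finished : Prefix rs (glue a L (λ _ → 0)) (L + 0) u
  finished = subst (λ N → Prefix rs (glue a L (λ _ → 0)) N u) (sym (ℕₚ.+-identityʳ L)) (Prefix-glue (λ _ → 0) p)
completions-done rs k a L u (suc d) u+1+d≡k p =
  cong +_ (≡-trans (count-zero k (λ e → Prefix? rs (glue a L e) (L + 0) k))
                   (𝟙-no (Prefix? rs _ (L + 0) k) too-few-labels))
  where
  too-few-labels : ¬ Prefix rs (glue a L (λ _ → 0)) (L + 0) k
  too-few-labels q = ℕₚ.m≢1+m+n u (≡-trans (Prefix-unique p q′) (≡-trans (sym u+1+d≡k) (ℕₚ.+-suc u d)))
    where
    q′ : Prefix rs a L k
    q′ = Prefix-unglue (λ _ → 0) (subst (λ N → Prefix rs (glue a L (λ _ → 0)) N k) (ℕₚ.+-identityʳ L) q)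

Free : List ℕ → (ℕ → ℕ) → ℕ → ℕ → ℕ → Set
Free rs a L u j = j < u × ¬ Clash rs a L j

Free? : ∀ rs a L u j → Dec (Free rs a L u j)
Free? rs a L u j = (j <? u) ×-dec ¬? (Hit? a (L ∸ rank rs L) (rank rs L) j)

-- Position L may join exactly u - rank L of the u blocks: the earlier members
-- of its distinguished set occupy rank L distinct blocks.
free-count : ∀ {rs a L u} k → Prefix rs a L u → u ≤ k →
  + Σ< k (λ j → 𝟙 (Free? rs a L u j)) ≡ + u -ℤ + rank rs L
free-count {rs} {a} {L} {u} k p u≤k = begin
    + Σ< k (λ j → 𝟙 (Free? rs a L u j))
  ≡⟨ cong +_ (Σ<-truncate _ u≤k (λ u≤j → 𝟙-no (Free? rs a L u _) (λ (j<u , _) → ℕₚ.<⇒≱ j<u u≤j))) ⟩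
    + Σ< u (λ j → 𝟙 (Free? rs a L u j))
  ≡⟨ cong +_ (Σ<-cong u (λ {j} j<u → 𝟙-⇔ proj₂ (j<u ,_) (Free? rs a L u j) (¬? (Hit? a s m j)))) ⟩
    + Σ< u (λ j → 𝟙 (¬? (Hit? a s m j)))
  ≡⟨ subtract (missed-labels a s m u (λ t<m → bounded p (proj₁ (window-member rs L t<m))) distinct) ⟩
    + u -ℤ + m ∎
  where
  open ≡-Reasoning
  open Prefix
  s m : ℕ
  s = L ∸ rank rs L
  m = rank rs L
  distinct : ∀ {t t′} → t < m → t′ < m → t ≢ t′ → a (s + t) ≢ a (s + t′)
  distinct t<m t′<m t≢t′ =
    let (s+t<L , same) = window-member rs L t<m ; (s+t′<L , same′) = window-member rs L t′<m
    in separated p s+t<L s+t′<L (λ eq → t≢t′ (ℕₚ.+-cancelˡ-≡ s _ _ eq)) (SameR-trans rs same (SameR-sym rs same′))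
  subtract : ∀ {x} → x + m ≡ u → + x ≡ + u -ℤ + m
  subtract {x} refl = ≡-trans (sym (cancel (+ x) (+ m))) (cong (_-ℤ + m) (sym (ℤₚ.pos-+ x m)))
    where
    cancel : ∀ x m → x +ℤ m -ℤ m ≡ x
    cancel = solve-∀

dead-label : ∀ {rs k a L u j} M → Prefix rs a L u → ¬ Free rs a L u j → j ≢ u →
  completions rs k (extend a L j) (suc L) M ≡ 0
dead-label {rs} {k} {a} {L} {u} {j} M p not-free j≢u =
  count-none M k (λ e → Prefix? rs (glue (extend a L j) (suc L) e) (suc L + M) k) impossible
  where
  impossible : ∀ e → ¬ Prefix rs (glue (extend a L j) (suc L) e) (suc L + M) k
  impossible e q = not-free (j<u , subst (λ x → ¬ Clash rs a L x) at fresh)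
    where
    L<N : L < suc L + M
    L<N = s≤s (ℕₚ.m≤m+n L M)
    below : ∀ {i} → i < L → glue (extend a L j) (suc L) e i ≡ a i
    below = glue-extend-< a L j e
    at : glue (extend a L j) (suc L) e L ≡ j
    at = glue-extend-at a L j e
    fresh : ¬ Clash rs a L (glue (extend a L j) (suc L) e L)
    fresh = continuation-fresh q L<N below
    j<u : j < u
    j<u = ℕₚ.≤∧≢⇒< (ℕₚ.≮⇒≥ (subst (λ x → ¬ u < x) at (continuation-≤ p q L<N below))) j≢u

out-of-range-label : ∀ {rs k a L} M → completions rs k (extend a L k) (suc L) M ≡ 0
out-of-range-label {rs} {k} {a} {L} M =
  count-none M k (λ e → Prefix? rs (glue (extend a L k) (suc L) e) (suc L + M) k) overflow
  where
  overflow : ∀ e → ¬ Prefix rs (glue (extend a L k) (suc L) e) (suc L + M) k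
  overflow e q = ℕₚ.<-irrefl refl (subst (_< k) (glue-extend-at a L k e) (Prefix.bounded q (s≤s (ℕₚ.m≤m+n L M))))

new-label-sum : ∀ ms u d k → u + d ≡ k → + Σ< k (λ j → 𝟙 (j ≟ u)) *ℤ W⁺ ms u d ≡ W⁺ ms u d
new-label-sum ms u zero    k _         = ℤₚ.*-zeroʳ (+ Σ< k (λ j → 𝟙 (j ≟ u)))
new-label-sum ms u (suc d) k u+1+d≡k
  rewrite Σ<-point (subst (u <_) (≡-trans (sym (ℕₚ.+-suc u d)) u+1+d≡k) (s≤s (ℕₚ.m≤m+n u d))) =
  ℤₚ.*-identityˡ (W ms (suc u) d)

-- Position L either joins one of the u - rank L free blocks, keeping u, or
-- opens block u; every other label is dead.
completions-W : ∀ rs k M L a u d → u + d ≡ k → Prefix rs a L u →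
  + completions rs k a L M ≡ W (ranks rs L M) u d
completions-W rs k zero    L a u d u+d≡k p = completions-done rs k a L u d u+d≡k p
completions-W rs k (suc M) L a u d u+d≡k p = begin
    + completions rs k a L (suc M)
  ≡⟨ cong +_ (completions-step rs k a L M) ⟩
    + Σ< k (λ j → completions rs k (extend a L j) (suc L) M)
  ≡⟨ Σ<-linear k _ (λ j → 𝟙 (Free? rs a L u j)) (λ j → 𝟙 (j ≟ u)) X Y by-label ⟩
    + Σ< k (λ j → 𝟙 (Free? rs a L u j)) *ℤ X +ℤ + Σ< k (λ j → 𝟙 (j ≟ u)) *ℤ Y
  ≡⟨ cong₂ _+ℤ_ (cong (_*ℤ X) (free-count k p u≤k)) (new-label-sum ms u d k u+d≡k) ⟩
    (+ u -ℤ + rank rs L) *ℤ X +ℤ Y ∎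
  where
  open ≡-Reasoning
  ms : List ℕ
  ms = ranks rs (suc L) M
  X Y : ℤ
  X = W ms u d
  Y = W⁺ ms u d
  u≤k : u ≤ k
  u≤k = subst (u ≤_) u+d≡k (ℕₚ.m≤m+n u d)
  opened : ∀ d → u + d ≡ k → + completions rs k (extend a L u) (suc L) M ≡ W⁺ ms u d
  opened zero    u+0≡k =
    cong +_ (subst (λ v → completions rs k (extend a L v) (suc L) M ≡ 0) (sym (≡-trans (sym (ℕₚ.+-identityʳ u)) u+0≡k))
                   (out-of-range-label M))
  opened (suc d) u+1+d≡k =
    completions-W rs k M (suc L) (extend a L u) (suc u) d (≡-trans (sym (ℕₚ.+-suc u d)) u+1+d≡k) (open-block p)
  by-label : ∀ j → + completions rs k (extend a L j) (suc L) M ≡ + 𝟙 (Free? rs a L u j) *ℤ X +ℤ + 𝟙 (j ≟ u) *ℤ Y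
  by-label j with Free? rs a L u j | j ≟ u
  ... | yes (j<u , _)     | yes refl = ⊥-elim (ℕₚ.<-irrefl refl j<u)
  ... | yes (j<u , fresh) | no _     =
    ≡-trans (completions-W rs k M (suc L) (extend a L j) u d u+d≡k (join p j<u fresh)) (only-first X Y)
    where
    only-first : ∀ X Y → X ≡ + 1 *ℤ X +ℤ + 0 *ℤ Y
    only-first = solve-∀
  ... | no _              | yes refl = ≡-trans (opened d u+d≡k) (only-second X Y)
    where
    only-second : ∀ X Y → Y ≡ + 0 *ℤ X +ℤ + 1 *ℤ Y
    only-second = solve-∀
  ... | no not-free       | no j≢u   = ≡-trans (cong +_ (dead-label M p not-free j≢u)) (neither X Y)
    where
    neither : ∀ X Y → + 0 ≡ + 0 *ℤ X +ℤ + 0 *ℤ Y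
    neither = solve-∀

seq-toℕ : ∀ {N k} (h : Fin N → Fin k) i → seq h (toℕ i) ≡ toℕ (h i)
seq-toℕ h Fin.zero    = refl
seq-toℕ h (Fin.suc i) = seq-toℕ (λ x → h (Fin.suc x)) i

seq-< : ∀ {N k} (h : Fin N → Fin k) {i} (i<N : i < N) → seq h i ≡ toℕ (h (fromℕ< i<N))
seq-< h i<N = ≡-trans (cong (seq h) (sym (Finₚ.toℕ-fromℕ< i<N))) (seq-toℕ h (fromℕ< i<N))

module _ (rs : List ℕ) {N k : ℕ} (h : Fin N → Fin k) where
  open Prefix

  admissible⇒prefix : Admissible rs h → Prefix rs (seq h) N k
  admissible⇒prefix (surj , canon , sep) = record
    { bounded   = λ i<N → subst (_< k) (sym (seq-< h i<N)) (Finₚ.toℕ<n _)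
    ; onto      = λ j<k → let (i , hi≡j) = surj (fromℕ< j<k)
                          in toℕ i , Finₚ.toℕ<n i , ≡-trans (seq-toℕ h i) (≡-trans (cong toℕ hi≡j) (Finₚ.toℕ-fromℕ< j<k))
    ; canonical = λ {i} i<N {j} j<hi →
        let j<hi′ = subst (j <_) (seq-< h i<N) j<hi
            j<k   = ℕₚ.<-trans j<hi′ (Finₚ.toℕ<n _)
            (i′ , i′<i , hi′≡j) = canon (fromℕ< i<N) (fromℕ< j<k) (subst (_< toℕ (h (fromℕ< i<N))) (sym (Finₚ.toℕ-fromℕ< j<k)) j<hi′)
        in toℕ i′ , subst (toℕ i′ <_) (Finₚ.toℕ-fromℕ< i<N) i′<i ,
           ≡-trans (seq-toℕ h i′) (≡-trans (cong toℕ hi′≡j) (Finₚ.toℕ-fromℕ< j<k))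
    ; separated = λ i<N i′<N i≢i′ same eq →
        sep (fromℕ< i<N) (fromℕ< i′<N)
            (λ fi≡fi′ → i≢i′ (≡-trans (sym (Finₚ.toℕ-fromℕ< i<N)) (≡-trans (cong toℕ fi≡fi′) (Finₚ.toℕ-fromℕ< i′<N))))
            (subst₂ (SameR rs) (sym (Finₚ.toℕ-fromℕ< i<N)) (sym (Finₚ.toℕ-fromℕ< i′<N)) same)
            (Finₚ.toℕ-injective (≡-trans (sym (seq-< h i<N)) (≡-trans eq (seq-< h i′<N))))
    }

  prefix⇒admissible : Prefix rs (seq h) N k → Admissible rs h
  prefix⇒admissible p = surj , canon , sep
    where
    surj : ∀ j → ∃ λ i → h i ≡ j
    surj j = let (i , i<N , eq) = onto p (Finₚ.toℕ<n j)
             in fromℕ< i<N , Finₚ.toℕ-injective (≡-trans (sym (seq-< h i<N)) eq)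
    canon : ∀ i j → j Fin.< h i → ∃ λ i′ → i′ Fin.< i × h i′ ≡ j
    canon i j j<hi =
      let (i′ , i′<i , eq) = canonical p (Finₚ.toℕ<n i) (subst (toℕ j <_) (sym (seq-toℕ h i)) j<hi)
          i′<N = ℕₚ.<-trans i′<i (Finₚ.toℕ<n i)
      in fromℕ< i′<N , subst (_< toℕ i) (sym (Finₚ.toℕ-fromℕ< i′<N)) i′<i ,
         Finₚ.toℕ-injective (≡-trans (sym (seq-< h i′<N)) eq)
    sep : ∀ i i′ → i ≢ i′ → SameR rs (toℕ i) (toℕ i′) → h i ≢ h i′
    sep i i′ i≢i′ same eq =
      separated p (Finₚ.toℕ<n i) (Finₚ.toℕ<n i′) (λ e → i≢i′ (Finₚ.toℕ-injective e)) same
        (≡-trans (seq-toℕ h i) (≡-trans (cong toℕ eq) (sym (seq-toℕ h i′))))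

stirlingR-count : ∀ N k rs → sum rs ≤ N → stirlingR N k rs ≡ count N k (λ e → Prefix? rs e N k)
stirlingR-count N k rs fits with sum rs ≤? N
... | no  doesn't-fit = ⊥-elim (doesn't-fit fits)
... | yes _ = begin
    length (filter (Admissible? rs) (allFuns N k))
  ≡⟨ length-filter (Admissible? rs) (allFuns N k) ⟩
    ΣL (allFuns N k) (λ h → 𝟙 (Admissible? rs h))
  ≡⟨ ΣL-cong (allFuns N k) (λ h → 𝟙-⇔ (admissible⇒prefix rs h) (prefix⇒admissible rs h)
                                       (Admissible? rs h) (Prefix? rs (seq h) N k)) ⟩
    ΣL (allFuns N k) (λ h → 𝟙 (Prefix? rs (seq h) N k))
  ≡⟨ sym (length-filter (λ h → Prefix? rs (seq h) N k) (allFuns N k)) ⟩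
    count N k (λ e → Prefix? rs e N k) ∎
  where open ≡-Reasoning

stirlingR-W : ∀ N k rs → sum rs ≤ N → + stirlingR N k rs ≡ W (ranks rs 0 N) 0 k
stirlingR-W N k rs fits = begin
    + stirlingR N k rs
  ≡⟨ cong +_ (stirlingR-count N k rs fits) ⟩
    + count N k (λ e → Prefix? rs e N k)
  ≡⟨ cong +_ (count-⇔ N k (λ e → Prefix? rs e N k) (λ e → Prefix? rs (glue (λ _ → 0) 0 e) N k)
                          (λ {e} → Prefix-resp (λ {i} _ → sym (from-start e i)))
                          (λ {e} → Prefix-resp (λ {i} _ → from-start e i))) ⟩
    + completions rs k (λ _ → 0) 0 N
  ≡⟨ completions-W rs k N 0 (λ _ → 0) 0 k refl (Prefix-empty rs (λ _ → 0)) ⟩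
    W (ranks rs 0 N) 0 k ∎
  where
  open ≡-Reasoning
  from-start : ∀ e i → glue (λ _ → 0) 0 e i ≡ e i
  from-start e i = glue-≮ (λ _ → 0) 0 e (λ ())

-- With the last distinguished set of size rp, the shifted Stirling numbers
-- are the insertion numbers of the runs of rs, starting from rp blocks: the
-- rp elements of the last set must open the first rp blocks.
stirlingR-runs : ∀ rs rp n d → + stirlingR (n + sum (rs ∷ʳ rp)) (d + rp) (rs ∷ʳ rp) ≡ W (runs rs n) rp d
stirlingR-runs rs rp n d = begin
    + stirlingR (n + sum rs′) (d + rp) rs′
  ≡⟨ stirlingR-W (n + sum rs′) (d + rp) rs′ (ℕₚ.m≤n+m (sum rs′) n) ⟩
    W (ranks rs′ 0 (n + sum rs′)) 0 (d + rp)
  ≡⟨ cong (λ ms → W ms 0 (d + rp)) (≡-trans (cong (ranks rs′ 0) (ℕₚ.+-comm n (sum rs′))) (ranks-runs rs′ n)) ⟩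
    W (runs rs′ n) 0 (d + rp)
  ≡⟨ W-perm (runs-∷ʳ rs rp n) 0 (d + rp) ⟩
    W (range 0 rp ++ runs rs n) 0 (d + rp)
  ≡⟨ cong (W (range 0 rp ++ runs rs n) 0) (ℕₚ.+-comm d rp) ⟩
    W (range 0 rp ++ runs rs n) 0 (rp + d)
  ≡⟨ W-range rp 0 (runs rs n) d ⟩
    W (runs rs n) (rp + 0) d
  ≡⟨ cong (λ u → W (runs rs n) u d) (ℕₚ.+-identityʳ rp) ⟩
    W (runs rs n) rp d ∎
  where
  open ≡-Reasoning
  rs′ : List ℕ
  rs′ = rs ∷ʳ rp

stirlingR-expansion : ∀ rs rp n z →
  prodL rs (fall (z +ℤ + rp)) *ℤ ((z +ℤ + rp) ^ℤ n)
    ≡ sumTo (n + sum rs) (λ k → + stirlingR (n + sum (rs ∷ʳ rp)) (k + rp) (rs ∷ʳ rp) *ℤ fall z k)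
stirlingR-expansion rs rp n z = sym (begin
    sumTo (n + sum rs) (λ k → + stirlingR (n + sum (rs ∷ʳ rp)) (k + rp) (rs ∷ʳ rp) *ℤ fall z k)
  ≡⟨ sumTo-cong (n + sum rs) (λ k → cong (_*ℤ fall z k) (stirlingR-runs rs rp n k)) ⟩
    sumTo (n + sum rs) (λ k → W (runs rs n) rp k *ℤ fall z k)
  ≡⟨ cong (λ M → sumTo M (λ k → W (runs rs n) rp k *ℤ fall z k))
          (≡-trans (ℕₚ.+-comm n (sum rs)) (sym (length-runs rs n))) ⟩
    sumTo (length (runs rs n)) (λ k → W (runs rs n) rp k *ℤ fall z k)
  ≡⟨ W-expansion (runs rs n) rp z ⟩
    prodL (runs rs n) (λ m → z +ℤ + rp -ℤ + m)
  ≡⟨ prodL-runs rs n (z +ℤ + rp) ⟩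
    prodL rs (fall (z +ℤ + rp)) *ℤ ((z +ℤ + rp) ^ℤ n) ∎)
  where open ≡-Reasoning

theorem5 :
    ((rs : List ℕ) (rp n : ℕ) → Sorted ≤-totalOrder (rs ∷ʳ rp) → (z : ℤ) →
      prodL rs (fall (z +ℤ + rp)) *ℤ ((z +ℤ + rp) ^ℤ n)
        ≡ sumTo (n + sum rs) (λ k → + stirlingR (n + sum (rs ∷ʳ rp)) (k + rp) (rs ∷ʳ rp) *ℤ fall z k))
    × ((r n : ℕ) → (z : ℤ) →
      (z +ℤ + r) ^ℤ n ≡ sumTo n (λ k → + stirlingR (n + r) (k + r) (r ∷ []) *ℤ fall z k))
theorem5 = (λ rs rp n _ → stirlingR-expansion rs rp n) , single
  where
  -- p = 1 is the case rs = [].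
  single : ∀ r n z → (z +ℤ + r) ^ℤ n ≡ sumTo n (λ k → + stirlingR (n + r) (k + r) (r ∷ []) *ℤ fall z k)
  single r n z = begin
      (z +ℤ + r) ^ℤ n
    ≡⟨ sym (ℤₚ.*-identityˡ _) ⟩
      prodL [] (fall (z +ℤ + r)) *ℤ (z +ℤ + r) ^ℤ n
    ≡⟨ stirlingR-expansion [] r n z ⟩
      sumTo (n + 0) (λ k → + stirlingR (n + (r + 0)) (k + r) (r ∷ []) *ℤ fall z k)
    ≡⟨ cong₂ (λ M r′ → sumTo M (λ k → + stirlingR (n + r′) (k + r) (r ∷ []) *ℤ fall z k))
             (ℕₚ.+-identityʳ n) (ℕₚ.+-identityʳ r) ⟩
      sumTo n (λ k → + stirlingR (n + r) (k + r) (r ∷ []) *ℤ fall z k) ∎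
    where open ≡-Reasoning
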